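{- Let $p\in\mathrm{OFS}(\mathbb{Z}^+)$, $d=\gcd(p)$, and $p/d=(p_1/d,\ldots,p_{|p|}/d)$. Then $p/d\in\mathrm{OFS}(\mathbb{Z}^+)$, $f(p)=d\,f(p/d)$, and $fw(p)=d\,fw(p/d)$.
   Context: $\mathrm{OFS}(\mathbb{Z}^+)$ denotes the set of all nonempty strictly increasing finite sequences of positive integers. For $p\in\mathrm{OFS}(\mathbb{Z}^+)$, $|p|$ is its length, $p_i$ its $i$-th entry, $p|_i=(p_1,\ldots,p_i)$, $\gcd(p)$ the gcd of its entries, $\max(p)=p_{|p|}$. The map $R$: $R(p)=p$ if $|p|=1$; if $n=|p|>1$, form $(p_2-p_1,\ldots,p_n-p_1)$ and, if $p_1$ does not appear in it, insert $p_1$ so that the result is strictly increasing. $f$ is defined recursively by $f(p)=p_1$ if $|p|=1$ and $f(p)=p_1+f(R(p))$ if $|p|>1$. $fw$ is defined by: if $n=|p|>1$, $\gcd(p|_{n-1})=\gcd(p)$ and $\max(p)\ge f(p|_{n-1})$, then $fw(p)=fw(p|_{n-1})$; otherwise $fw(p)=f(p)$. -}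

module Defs where

open import Data.Nat using (ℕ; zero; suc; _+_; _∸_; _<_; _≤_; _≤?_; _<ᵇ_)
open import Data.Nat.Properties using (_≟_)
open import Data.Nat.GCD using (gcd)
open import Data.Bool using (Bool; true; false; if_then_else_; _∧_)
open import Data.List using (List; []; _∷_; map; length; take; foldr)
open import Data.Nat.ListAction using (sum)
open import Data.List.Relation.Unary.All using (All)
open import Data.List.Relation.Unary.Linked using (Linked)
open import Data.Product using (_×_)
open import Relation.Nullary.Decidable using (⌊_⌋)
open import Relation.Binary.PropositionalEquality using (_≢_)

OFS : List ℕ → Set
OFS p = (p ≢ []) × All (0 <_) p × Linked _<_ p

gcdL : List ℕ → ℕ
gcdL = foldr gcd 0

-- max(p) = last entry p_{|p|}  (0 on the empty list, never used)
lastL : List ℕ → ℕ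
lastL []           = 0
lastL (x ∷ [])     = x
lastL (_ ∷ y ∷ ys) = lastL (y ∷ ys)

elemᵇ : ℕ → List ℕ → Bool
elemᵇ x []       = false
elemᵇ x (y ∷ ys) = if ⌊ x ≟ y ⌋ then true else elemᵇ x ys

insertSorted : ℕ → List ℕ → List ℕ
insertSorted x []       = x ∷ []
insertSorted x (y ∷ ys) = if x <ᵇ y then x ∷ y ∷ ys else y ∷ insertSorted x ys

R : List ℕ → List ℕ
R []           = []
R (x ∷ [])     = x ∷ []
R (x ∷ y ∷ ys) =
  let ds = map (λ z → z ∸ x) (y ∷ ys)
  in if elemᵇ x ds then ds else insertSorted x ds

-- f, by recursion with fuel (max strictly decreases under R, so fuel
-- sum p + 1 always suffices on OFS inputs)
fFuel : ℕ → List ℕ → ℕ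
fFuel zero    _            = 0
fFuel (suc k) []           = 0
fFuel (suc k) (x ∷ [])     = x
fFuel (suc k) (x ∷ y ∷ ys) = x + fFuel k (R (x ∷ y ∷ ys))

f : List ℕ → ℕ
f p = fFuel (suc (sum p)) p

fwFuel : ℕ → List ℕ → ℕ
fwFuel zero    p = f p
fwFuel (suc k) p =
  let n  = length p
      pi = take (n ∸ 1) p
  in if ((1 <ᵇ n) ∧ ⌊ gcdL pi ≟ gcdL p ⌋ ∧ ⌊ f pi ≤? lastL p ⌋)
     then fwFuel k pi
     else f p

fw : List ℕ → ℕ
fw p = fwFuel (length p) p

module Submission where

-- Since d divides every entry, p = d·q (entrywise), so the proposition is
-- the statement that f and fw are homogeneous: f(c·q) = c·f(q) and
-- fw(c·q) = c·fw(q) for every c > 0 and every positive increasing q.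
--  * Every test inside R, f and fw (equality, ≤, <, membership, gcd
--    comparisons) gives the same answer on c·q as on q, and subtraction
--    commutes with scaling; hence R(c·q) = c·R(q), and the fuelled
--    recursion fFuel satisfies fFuel k (c·q) = c·fFuel k q for every fuel k.
--  * f runs fFuel with fuel 1 + sum, which differs for q and c·q.  On
--    positive increasing lists R preserves this shape and strictly lowers
--    the sum, so any fuel exceeding the sum gives the same value.
--  * fw only compares gcds, last entries and values of f on prefixes of q,
--    all of which scale by c, so fw(c·q) = c·fw(q) by induction on the fuel.
-- Finally q is again OFS because the conditions defining OFS are invariant
-- under scaling by c > 0.

open import Defs
open import Data.Nat using (ℕ; _*_; _/_; NonZero)
open import Data.List using (List; map)
open import Data.Product using (Σ; _×_)
open import Relation.Binary.PropositionalEquality using (_≡_)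

open import Data.Nat
  using (zero; suc; _+_; _∸_; _<_; _≤_; _≤?_; _<?_; _<ᵇ_; z≤n; s≤s;
         ≢-nonZero; >-nonZero; >-nonZero⁻¹)
open import Data.Nat.Properties
import Algebra.Properties.CommutativeSemigroup +-commutativeSemigroup as +-CS
open import Data.Nat.GCD
  using (gcd; gcd[m,n]∣m; gcd[m,n]∣n; c*gcd[m,n]≡gcd[cm,cn]; gcd[m,n]≡0⇒m≡0)
open import Data.Nat.Divisibility using (_∣_; ∣-trans)
open import Data.Nat.DivMod using (m*[n/m]≡n)
open import Data.Nat.ListAction using (sum)
open import Data.Bool using (Bool; true; false; if_then_else_; _∧_)
open import Data.Bool.Properties using (if-float; if-cong; if-cong₂)
open import Data.List using ([]; _∷_; length; take)
open import Data.List.Properties using (take-map; length-map)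
open import Data.List.Relation.Unary.All using (All; []; _∷_)
import Data.List.Relation.Unary.All as All
import Data.List.Relation.Unary.All.Properties as All
open import Data.List.Relation.Unary.Linked using (Linked; []; [-]; _∷_)
import Data.List.Relation.Unary.Linked as Linked
import Data.List.Relation.Unary.Linked.Properties as Linked
open import Data.Product using (_,_; proj₂)
open import Data.Empty using (⊥-elim)
open import Function.Bundles using (_⇔_; mk⇔)
open import Relation.Nullary using (Dec; yes; no)
open import Relation.Nullary.Decidable using (⌊_⌋; isYes≗does; does-⇔)
open import Relation.Nullary.Reflects using (ofʸ; ofⁿ)
open import Relation.Binary.PropositionalEquality
  using (≢-sym; refl; sym; trans; cong; cong₂; subst; module ≡-Reasoning)

scale : ℕ → List ℕ → List ℕ
scale c = map (c *_)

-- The step of R after subtracting the head x: adjoin x unless already present.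
adjoin : ℕ → List ℕ → List ℕ
adjoin x D = if elemᵇ x D then D else insertSorted x D

Increasing : List ℕ → Set
Increasing L = All (0 <_) L × Linked _<_ L

⌊⌋-⇔ : {A B : Set} → A ⇔ B → (a? : Dec A) (b? : Dec B) → ⌊ a? ⌋ ≡ ⌊ b? ⌋
⌊⌋-⇔ A⇔B a? b? =
  trans (isYes≗does a?) (trans (does-⇔ A⇔B a? b?) (sym (isYes≗does b?)))

≟-scale : ∀ c .{{_ : NonZero c}} x y → ⌊ c * x ≟ c * y ⌋ ≡ ⌊ x ≟ y ⌋
≟-scale c x y = ⌊⌋-⇔ (mk⇔ (*-cancelˡ-≡ x y c) (cong (c *_))) _ _

≤?-scale : ∀ c .{{_ : NonZero c}} x y → ⌊ c * x ≤? c * y ⌋ ≡ ⌊ x ≤? y ⌋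
≤?-scale c x y = ⌊⌋-⇔ (mk⇔ (*-cancelˡ-≤ c) (*-monoʳ-≤ c)) _ _

<ᵇ-scale : ∀ c .{{_ : NonZero c}} x y → (c * x <ᵇ c * y) ≡ (x <ᵇ y)
<ᵇ-scale c x y =
  does-⇔ (mk⇔ (*-cancelˡ-< c x y) (*-monoʳ-< c)) (c * x <? c * y) (x <? y)

elemᵇ-scale : ∀ c .{{_ : NonZero c}} x L → elemᵇ (c * x) (scale c L) ≡ elemᵇ x L
elemᵇ-scale c x []       = refl
elemᵇ-scale c x (y ∷ ys) =
  cong₂ (λ b r → if b then true else r) (≟-scale c x y) (elemᵇ-scale c x ys)

insertSorted-scale : ∀ c .{{_ : NonZero c}} x L →
  insertSorted (c * x) (scale c L) ≡ scale c (insertSorted x L)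
insertSorted-scale c x []       = refl
insertSorted-scale c x (y ∷ ys) = trans
  (cong₂ (λ b r → if b then c * x ∷ c * y ∷ scale c ys else c * y ∷ r)
         (<ᵇ-scale c x y) (insertSorted-scale c x ys))
  (sym (if-float (scale c) (x <ᵇ y)))

adjoin-scale : ∀ c .{{_ : NonZero c}} x D →
  adjoin (c * x) (scale c D) ≡ scale c (adjoin x D)
adjoin-scale c x D = trans
  (cong₂ (λ b r → if b then scale c D else r)
         (elemᵇ-scale c x D) (insertSorted-scale c x D))
  (sym (if-float (scale c) (elemᵇ x D)))

∸-scale : ∀ c x L →
  map (λ z → z ∸ c * x) (scale c L) ≡ scale c (map (λ z → z ∸ x) L)
∸-scale c x []       = refl
∸-scale c x (y ∷ ys) = cong₂ _∷_ (sym (*-distribˡ-∸ c y x)) (∸-scale c x ys)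

R-scale : ∀ c .{{_ : NonZero c}} L → R (scale c L) ≡ scale c (R L)
R-scale c []           = refl
R-scale c (x ∷ [])     = refl
R-scale c (x ∷ y ∷ ys) = trans (cong (adjoin (c * x)) (∸-scale c x (y ∷ ys)))
                               (adjoin-scale c x (map (λ z → z ∸ x) (y ∷ ys)))

fFuel-scale : ∀ c .{{_ : NonZero c}} k L → fFuel k (scale c L) ≡ c * fFuel k L
fFuel-scale c zero    L            = sym (*-zeroʳ c)
fFuel-scale c (suc k) []           = sym (*-zeroʳ c)
fFuel-scale c (suc k) (x ∷ [])     = refl
fFuel-scale c (suc k) (x ∷ y ∷ ys) = begin
  c * x + fFuel k (R (scale c (x ∷ y ∷ ys)))
    ≡⟨ cong (λ L → c * x + fFuel k L) (R-scale c (x ∷ y ∷ ys)) ⟩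
  c * x + fFuel k (scale c (R (x ∷ y ∷ ys)))
    ≡⟨ cong (c * x +_) (fFuel-scale c k (R (x ∷ y ∷ ys))) ⟩
  c * x + c * fFuel k (R (x ∷ y ∷ ys))
    ≡⟨ sym (*-distribˡ-+ c x _) ⟩
  c * (x + fFuel k (R (x ∷ y ∷ ys))) ∎
  where open ≡-Reasoning

∸-increasing : ∀ {x L} → All (x <_) L → Linked _<_ L →
  Increasing (map (λ z → z ∸ x) L)
∸-increasing x<L lk =
  All.map⁺ (All.map m<n⇒0<n∸m x<L) , Linked.map⁺ (go x<L lk)
  where
  go : ∀ {x L} → All (x <_) L → Linked _<_ L →
       Linked (λ y z → y ∸ x < z ∸ x) L
  go []            []         = []
  go (_ ∷ [])      [-]        = [-]
  go (x<y ∷ x<L)   (y<z ∷ lk) = ∸-monoˡ-< y<z (<⇒≤ x<y) ∷ go x<L lk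

insertSorted-above : ∀ {z x} L → z < x → elemᵇ x L ≡ false →
  Linked _<_ (z ∷ L) → Linked _<_ (z ∷ insertSorted x L)
insertSorted-above []       z<x _ _ = z<x ∷ [-]
insertSorted-above {x = x} (y ∷ ys) z<x x∉ (z<y ∷ lk) with x ≟ y | x∉
... | yes _  | ()
... | no x≢y | x∉ys with x <ᵇ y | <ᵇ-reflects-< x y
...   | true  | ofʸ x<y = z<x ∷ x<y ∷ lk
...   | false | ofⁿ x≮y =
  z<y ∷ insertSorted-above ys (≤∧≢⇒< (≮⇒≥ x≮y) (≢-sym x≢y)) x∉ys lk

insertSorted-linked : ∀ {x} L → elemᵇ x L ≡ false → Linked _<_ L →
  Linked _<_ (insertSorted x L)
insertSorted-linked []       _  _  = [-]
insertSorted-linked {x} (y ∷ ys) x∉ lk with x ≟ y | x∉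
... | yes _  | ()
... | no x≢y | x∉ys with x <ᵇ y | <ᵇ-reflects-< x y
...   | true  | ofʸ x<y = x<y ∷ lk
...   | false | ofⁿ x≮y =
  insertSorted-above ys (≤∧≢⇒< (≮⇒≥ x≮y) (≢-sym x≢y)) x∉ys lk

insertSorted-all : ∀ {P : ℕ → Set} {x} L → P x → All P L → All P (insertSorted x L)
insertSorted-all     []       px []         = px ∷ []
insertSorted-all {x = x} (y ∷ ys) px (py ∷ pys) with x <ᵇ y
... | true  = px ∷ py ∷ pys
... | false = py ∷ insertSorted-all ys px pys

adjoin-increasing : ∀ {x} D → 0 < x → Increasing D → Increasing (adjoin x D)
adjoin-increasing {x} D 0<x (pos , lk) with elemᵇ x D in x∈D?
... | true  = pos , lk
... | false = insertSorted-all D 0<x pos , insertSorted-linked D x∈D? lk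

R-increasing : ∀ {x y ys} → Increasing (x ∷ y ∷ ys) → Increasing (R (x ∷ y ∷ ys))
R-increasing (0<x ∷ _ , lk@(_ ∷ lk′)) =
  adjoin-increasing _ 0<x (∸-increasing (Linked.Linked⇒All <-trans (Linked.head lk) lk′) lk′)

sum-insertSorted : ∀ x L → sum (insertSorted x L) ≡ x + sum L
sum-insertSorted x []       = refl
sum-insertSorted x (y ∷ ys) with x <ᵇ y
... | true  = refl
... | false = trans (cong (y +_) (sum-insertSorted x ys)) (+-CS.x∙yz≈y∙xz y x (sum ys))

sum-adjoin : ∀ x D → sum (adjoin x D) ≤ x + sum D
sum-adjoin x D with elemᵇ x D
... | true  = m≤n+m (sum D) x
... | false = ≤-reflexive (sum-insertSorted x D)

sum-∸ : ∀ x L → sum (map (λ z → z ∸ x) L) ≤ sum L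
sum-∸ x []       = z≤n
sum-∸ x (y ∷ ys) = +-mono-≤ (m∸n≤m y x) (sum-∸ x ys)

R-sum-< : ∀ {x y} ys → 0 < x → x ≤ y → sum (R (x ∷ y ∷ ys)) < sum (x ∷ y ∷ ys)
R-sum-< {x} {y} ys 0<x x≤y = begin-strict
  sum (adjoin x D)                            ≤⟨ sum-adjoin x D ⟩
  x + ((y ∸ x) + sum (map (λ z → z ∸ x) ys))  ≡⟨ +-assoc x (y ∸ x) _ ⟨
  x + (y ∸ x) + sum (map (λ z → z ∸ x) ys)    ≤⟨ +-mono-≤ (≤-reflexive (m+[n∸m]≡n x≤y)) (sum-∸ x ys) ⟩
  y + sum ys                                  <⟨ m<n+m (y + sum ys) 0<x ⟩
  x + (y + sum ys)                            ∎
  where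
  open ≤-Reasoning
  D : List ℕ
  D = map (λ z → z ∸ x) (y ∷ ys)

fFuel-stable : ∀ {k k′} q → Increasing q → sum q < k → sum q < k′ →
  fFuel k q ≡ fFuel k′ q
fFuel-stable []           _   (s≤s _) (s≤s _) = refl
fFuel-stable (x ∷ [])     _   (s≤s _) (s≤s _) = refl
fFuel-stable (x ∷ y ∷ ys) inc@(0<x ∷ _ , x<y ∷ _) (s≤s q<k) (s≤s q<k′) =
  cong (x +_) (fFuel-stable (R (x ∷ y ∷ ys)) (R-increasing inc)
                 (<-≤-trans decrease q<k) (<-≤-trans decrease q<k′))
  where
  decrease : sum (R (x ∷ y ∷ ys)) < sum (x ∷ y ∷ ys)
  decrease = R-sum-< ys 0<x (<⇒≤ x<y)

-- Scaling by c > 0 does not decrease the sum, so its fuel is also adequate.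
sum-≤-scale : ∀ c .{{_ : NonZero c}} L → sum L ≤ sum (scale c L)
sum-≤-scale c []       = z≤n
sum-≤-scale c (x ∷ xs) = +-mono-≤ (m≤n*m x c) (sum-≤-scale c xs)

f-scale : ∀ c .{{_ : NonZero c}} q → Increasing q → f (scale c q) ≡ c * f q
f-scale c q inc = begin
  fFuel (suc (sum (scale c q))) (scale c q) ≡⟨ fFuel-scale c (suc (sum (scale c q))) q ⟩
  c * fFuel (suc (sum (scale c q))) q
    ≡⟨ cong (c *_) (fFuel-stable q inc (s≤s (sum-≤-scale c q)) ≤-refl) ⟩
  c * f q                                   ∎
  where open ≡-Reasoning

prefix : List ℕ → List ℕ
prefix L = take (length L ∸ 1) L

descends : List ℕ → Bool
descends L = (1 <ᵇ length L) ∧ ⌊ gcdL (prefix L) ≟ gcdL L ⌋ ∧ ⌊ f (prefix L) ≤? lastL L ⌋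

gcdL-scale : ∀ c L → gcdL (scale c L) ≡ c * gcdL L
gcdL-scale c []       = sym (*-zeroʳ c)
gcdL-scale c (x ∷ xs) = trans (cong (gcd (c * x)) (gcdL-scale c xs))
                              (sym (c*gcd[m,n]≡gcd[cm,cn] c x (gcdL xs)))

lastL-scale : ∀ c L → lastL (scale c L) ≡ c * lastL L
lastL-scale c []           = sym (*-zeroʳ c)
lastL-scale c (x ∷ [])     = refl
lastL-scale c (x ∷ y ∷ ys) = lastL-scale c (y ∷ ys)

prefix-scale : ∀ c L → prefix (scale c L) ≡ scale c (prefix L)
prefix-scale c L = trans (cong (λ n → take (n ∸ 1) (scale c L)) (length-map (c *_) L))
                         (take-map (length L ∸ 1) L)

take-linked : ∀ {R : ℕ → ℕ → Set} n L → Linked R L → Linked R (take n L)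
take-linked zero          L            _          = []
take-linked (suc n)       []           _          = []
take-linked (suc zero)    (x ∷ L)      _          = [-]
take-linked (suc (suc n)) (x ∷ [])     _          = [-]
take-linked (suc (suc n)) (x ∷ y ∷ L) (rxy ∷ lk) = rxy ∷ take-linked (suc n) (y ∷ L) lk

prefix-increasing : ∀ L → Increasing L → Increasing (prefix L)
prefix-increasing L (pos , lk) =
  All.take⁺ (length L ∸ 1) pos , take-linked (length L ∸ 1) L lk

descends-scale : ∀ c .{{_ : NonZero c}} L → Increasing L →
  descends (scale c L) ≡ descends L
descends-scale c L inc =
  cong₂ _∧_ (cong (1 <ᵇ_) (length-map (c *_) L)) (cong₂ _∧_ gcd-test last-test)
  where
  open ≡-Reasoning
  gcd-test : ⌊ gcdL (prefix (scale c L)) ≟ gcdL (scale c L) ⌋ ≡ ⌊ gcdL (prefix L) ≟ gcdL L ⌋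
  gcd-test = begin
    ⌊ gcdL (prefix (scale c L)) ≟ gcdL (scale c L) ⌋
      ≡⟨ cong (λ P → ⌊ gcdL P ≟ gcdL (scale c L) ⌋) (prefix-scale c L) ⟩
    ⌊ gcdL (scale c (prefix L)) ≟ gcdL (scale c L) ⌋
      ≡⟨ cong₂ (λ a b → ⌊ a ≟ b ⌋) (gcdL-scale c (prefix L)) (gcdL-scale c L) ⟩
    ⌊ c * gcdL (prefix L) ≟ c * gcdL L ⌋
      ≡⟨ ≟-scale c (gcdL (prefix L)) (gcdL L) ⟩
    ⌊ gcdL (prefix L) ≟ gcdL L ⌋ ∎
  last-test : ⌊ f (prefix (scale c L)) ≤? lastL (scale c L) ⌋ ≡ ⌊ f (prefix L) ≤? lastL L ⌋
  last-test = begin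
    ⌊ f (prefix (scale c L)) ≤? lastL (scale c L) ⌋
      ≡⟨ cong (λ P → ⌊ f P ≤? lastL (scale c L) ⌋) (prefix-scale c L) ⟩
    ⌊ f (scale c (prefix L)) ≤? lastL (scale c L) ⌋
      ≡⟨ cong₂ (λ a b → ⌊ a ≤? b ⌋) (f-scale c (prefix L) (prefix-increasing L inc))
                                    (lastL-scale c L) ⟩
    ⌊ c * f (prefix L) ≤? c * lastL L ⌋
      ≡⟨ ≤?-scale c (f (prefix L)) (lastL L) ⟩
    ⌊ f (prefix L) ≤? lastL L ⌋ ∎

fwFuel-scale : ∀ c .{{_ : NonZero c}} k L → Increasing L →
  fwFuel k (scale c L) ≡ c * fwFuel k L
fwFuel-scale c zero    L inc = f-scale c L inc
fwFuel-scale c (suc k) L inc = begin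
  (if descends (scale c L) then fwFuel k (prefix (scale c L)) else f (scale c L))
    ≡⟨ if-cong (descends-scale c L inc) ⟩
  (if descends L then fwFuel k (prefix (scale c L)) else f (scale c L))
    ≡⟨ if-cong₂ (descends L) prefix-step (f-scale c L inc) ⟩
  (if descends L then c * fwFuel k (prefix L) else c * f L)
    ≡⟨ if-float (c *_) (descends L) ⟨
  c * (if descends L then fwFuel k (prefix L) else f L) ∎
  where
  open ≡-Reasoning
  prefix-step : fwFuel k (prefix (scale c L)) ≡ c * fwFuel k (prefix L)
  prefix-step = trans (cong (fwFuel k) (prefix-scale c L))
                      (fwFuel-scale c k (prefix L) (prefix-increasing L inc))

fw-scale : ∀ c .{{_ : NonZero c}} q → Increasing q → fw (scale c q) ≡ c * fw q
fw-scale c q inc = trans (cong (λ n → fwFuel n (scale c q)) (length-map (c *_) q))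
                         (fwFuel-scale c (length q) q inc)

gcdL-divides : ∀ L → All (gcdL L ∣_) L
gcdL-divides []       = []
gcdL-divides (x ∷ xs) = gcd[m,n]∣m x (gcdL xs)
                      ∷ All.map (∣-trans (gcd[m,n]∣n x (gcdL xs))) (gcdL-divides xs)

gcdL-nonZero : ∀ p → OFS p → NonZero (gcdL p)
gcdL-nonZero []       (p≢[] , _)       = ⊥-elim (p≢[] refl)
gcdL-nonZero (x ∷ xs) (_ , 0<x ∷ _ , _) =
  ≢-nonZero (λ gcd≡0 → n>0⇒n≢0 0<x (gcd[m,n]≡0⇒m≡0 gcd≡0))

scale-quotients : ∀ d .{{_ : NonZero d}} L → All (d ∣_) L → scale d (map (_/ d) L) ≡ L
scale-quotients d []       []           = refl
scale-quotients d (x ∷ xs) (d∣x ∷ d∣xs) = cong₂ _∷_ (m*[n/m]≡n d∣x) (scale-quotients d xs d∣xs)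

increasing-unscale : ∀ c L → Increasing (scale c L) → Increasing L
increasing-unscale c L (pos , lk) =
  All.map positive (All.map⁻ pos) , Linked.map (*-cancelˡ-< c _ _) (Linked.map⁻ lk)
  where
  positive : ∀ {x} → 0 < c * x → 0 < x
  positive {x} 0<cx = >-nonZero⁻¹ x {{m*n≢0⇒n≢0 c {{>-nonZero 0<cx}}}}

quotient-OFS : ∀ d .{{_ : NonZero d}} p → All (d ∣_) p → OFS p → OFS (map (_/ d) p)
quotient-OFS d []         _   (p≢[] , _) = ⊥-elim (p≢[] refl)
quotient-OFS d p@(_ ∷ _) d∣p (_ , inc)  =
  (λ ()) , increasing-unscale d _ (subst Increasing (sym (scale-quotients d p d∣p)) inc)

proposition7 : (p : List ℕ) → OFS p →
    Σ (NonZero (gcdL p)) λ nz →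
    OFS (map (λ x → _/_ x (gcdL p) {{nz}}) p) ×
    f p ≡ gcdL p * f (map (λ x → _/_ x (gcdL p) {{nz}}) p) ×
    fw p ≡ gcdL p * fw (map (λ x → _/_ x (gcdL p) {{nz}}) p)
proposition7 p ofs = d≢0 , q-ofs , f-homogeneous , fw-homogeneous
  where
  d : ℕ
  d = gcdL p
  instance
    d≢0 : NonZero d
    d≢0 = gcdL-nonZero p ofs
  q : List ℕ
  q = map (_/ d) p
  q-ofs : OFS q
  q-ofs = quotient-OFS d p (gcdL-divides p) ofs
  p≡d·q : p ≡ scale d q
  p≡d·q = sym (scale-quotients d p (gcdL-divides p))
  f-homogeneous : f p ≡ d * f q
  f-homogeneous = trans (cong f p≡d·q) (f-scale d q (proj₂ q-ofs))
  fw-homogeneous : fw p ≡ d * fw q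
  fw-homogeneous = trans (cong fw p≡d·q) (fw-scale d q (proj₂ q-ofs))
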